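{- Let $T$ be a decidable positive existential theory that eliminates transitive closures of binary relations. Then the emptiness problem for $T$-definable (non-deterministic) automata is decidable: given a $T$-definable automaton $\langle s_0\colon I\rightarrowtail S,\ s_f\colon F\rightarrowtail S,\ \sigma\colon\Sigma\times S\nrightarrow S\rangle$, it is decidable whether its language $L(A)$ is empty.
   Context: Positive existential formulas are built from $\top,\bot$, atomic relations, equations between terms, $\wedge,\vee,\exists$; a positive existential theory $T$ is a set of sequents between them, decidable if provability of sequents is decidable. $T$-definable sets are positive existential formulas in a context modulo $T$-provable equivalence, with $T$-definable functions and relations. $T$ eliminates transitive closures if for every $T$-definable binary relation $R$ there is finite $n$ with $R\vee R^2\vee\dots\vee R^n$ transitive. Assume $T$ has disjoint coproducts and eliminates imaginaries, and let $\mathbf{Set}(T)$ be its classifying topos (sheaves on the category of $T$-definable sets with the coherent topology). A non-deterministic automaton in $\mathbf{Set}(T)$ consists of an object of states $S$, a monomorphism $s_0\colon I\rightarrowtail S$ of initial states, a monomorphism $s_f\colon F\rightarrowtail S$ of final states, and a transition relation $\sigma\colon\Sigma\times S\nrightarrow S$; it is a $T$-automaton ($T$-definable) if all these data are $T$-definable. The transition relation induces, via the free monoid $\Sigma^*$ and the monoid of binary relations on $S$ under composition, a relation $\overline{\sigma}\colon\Sigma^*\times S\nrightarrow S$; the language $L(A)\subseteq\Sigma^*$ is the composite relation $\Sigma^*\nrightarrow\Sigma^*\times S\nrightarrow S\nrightarrow 1$ given by $(\mathrm{id}\times s_0)$, $\overline{\sigma}$ and $s_f$, i.e. the words $w$ that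 lead from some initial state to some final state. -}

module Defs where

open import Data.List using (List; []; _∷_; _++_)
open import Data.Nat using (ℕ; zero; suc)
open import Data.Product using (Σ; ∃; _×_; _,_)
open import Relation.Nullary using (Dec)

record Signature : Set₁ where
  field
    Sort : Set
    Fun  : Set
    fdom : Fun → List Sort
    fcod : Fun → Sort
    Rel  : Set
    rdom : Rel → List Sort

module Logic (Sg : Signature) where
  open Signature Sg

  -- contexts; the head of the list is the most recently bound variable
  Ctx : Set
  Ctx = List Sort

  -- context concatenation: Γ ⧺ Δ extends Γ by the variables of Δ
  infixl 5 _⧺_
  _⧺_ : Ctx → Ctx → Ctx
  Γ ⧺ Δ = Δ ++ Γ

  data Var : Ctx → Sort → Set where
    vz : ∀ {Γ A} → Var (A ∷ Γ) A
    vs : ∀ {Γ A B} → Var Γ A → Var (B ∷ Γ) A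

  mutual
    data Tm (Γ : Ctx) : Sort → Set where
      var : ∀ {A} → Var Γ A → Tm Γ A
      app : (f : Fun) → Tms Γ (fdom f) → Tm Γ (fcod f)

    data Tms (Γ : Ctx) : List Sort → Set where
      []  : Tms Γ []
      _∷_ : ∀ {A As} → Tm Γ A → Tms Γ As → Tms Γ (A ∷ As)

  infixr 6 _∧'_
  infixr 5 _∨'_
  infix 7 _≐_
  data Fm (Γ : Ctx) : Set where
    ⊤' ⊥'  : Fm Γ
    rel    : (R : Rel) → Tms Γ (rdom R) → Fm Γ
    _≐_    : ∀ {A} → Tm Γ A → Tm Γ A → Fm Γ
    _∧'_   : Fm Γ → Fm Γ → Fm Γ
    _∨'_   : Fm Γ → Fm Γ → Fm Γ
    ∃'     : ∀ {A} → Fm (A ∷ Γ) → Fm Γ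

  Ren : Ctx → Ctx → Set
  Ren Γ Δ = ∀ {A} → Var Δ A → Var Γ A

  Sub : Ctx → Ctx → Set
  Sub Γ Δ = ∀ {A} → Var Δ A → Tm Γ A

  mutual
    renT : ∀ {Γ Δ A} → Ren Γ Δ → Tm Δ A → Tm Γ A
    renT ρ (var x)    = var (ρ x)
    renT ρ (app f ts) = app f (renTs ρ ts)

    renTs : ∀ {Γ Δ As} → Ren Γ Δ → Tms Δ As → Tms Γ As
    renTs ρ []       = []
    renTs ρ (t ∷ ts) = renT ρ t ∷ renTs ρ ts

  mutual
    subT : ∀ {Γ Δ A} → Sub Γ Δ → Tm Δ A → Tm Γ A
    subT σ (var x)    = σ x
    subT σ (app f ts) = app f (subTs σ ts)

    subTs : ∀ {Γ Δ As} → Sub Γ Δ → Tms Δ As → Tms Γ As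
    subTs σ []       = []
    subTs σ (t ∷ ts) = subT σ t ∷ subTs σ ts

  liftS : ∀ {Γ Δ B} → Sub Γ Δ → Sub (B ∷ Γ) (B ∷ Δ)
  liftS σ vz     = var vz
  liftS σ (vs x) = renT vs (σ x)

  sub : ∀ {Γ Δ} → Sub Γ Δ → Fm Δ → Fm Γ
  sub σ ⊤'        = ⊤'
  sub σ ⊥'        = ⊥'
  sub σ (rel R ts) = rel R (subTs σ ts)
  sub σ (t ≐ u)   = subT σ t ≐ subT σ u
  sub σ (φ ∧' ψ)  = sub σ φ ∧' sub σ ψ
  sub σ (φ ∨' ψ)  = sub σ φ ∨' sub σ ψ
  sub σ (∃' φ)    = ∃' (sub (liftS σ) φ)

  ren : ∀ {Γ Δ} → Ren Γ Δ → Fm Δ → Fm Γ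
  ren ρ = sub (λ x → var (ρ x))

  wk : ∀ {Γ B} → Fm Γ → Fm (B ∷ Γ)
  wk = ren vs

  sub0 : ∀ {Γ A} → Tm Γ A → Sub Γ (A ∷ Γ)
  sub0 t vz     = t
  sub0 t (vs x) = var x

  wkL : ∀ {Γ} Δ → Ren (Γ ⧺ Δ) Γ
  wkL []      x = x
  wkL (B ∷ Δ) x = vs (wkL Δ x)

  wkR : ∀ Γ {Δ} → Ren (Γ ⧺ Δ) Δ
  wkR Γ vz     = vz
  wkR Γ (vs x) = vs (wkR Γ x)

  [_,_] : ∀ {Γ Δ Θ} → Ren Θ Γ → Ren Θ Δ → Ren Θ (Γ ⧺ Δ)
  [_,_] {Δ = []}    f g x      = f x
  [_,_] {Δ = B ∷ Δ} f g vz     = g vz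
  [_,_] {Δ = B ∷ Δ} f g (vs x) = [ f , (λ y → g (vs y)) ] x

  π₁ : ∀ {Γ Δ Θ} → Ren ((Γ ⧺ Δ) ⧺ Θ) Γ
  π₁ {Γ} {Δ} {Θ} x = wkL Θ (wkL Δ x)

  π₂ : ∀ {Γ Δ Θ} → Ren ((Γ ⧺ Δ) ⧺ Θ) Δ
  π₂ {Γ} {Δ} {Θ} x = wkL Θ (wkR Γ x)

  π₃ : ∀ {Γ Δ Θ} → Ren ((Γ ⧺ Δ) ⧺ Θ) Θ
  π₃ {Γ} {Δ} {Θ} x = wkR (Γ ⧺ Δ) x

  ∃* : ∀ {Γ} Δ → Fm (Γ ⧺ Δ) → Fm Γ
  ∃* []      φ = φ
  ∃* (B ∷ Δ) φ = ∃* Δ (∃' φ)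

  eqs : ∀ {Θ} Δ → Ren Θ Δ → Ren Θ Δ → Fm Θ
  eqs []      f g = ⊤'
  eqs (B ∷ Δ) f g = (var (f vz) ≐ var (g vz)) ∧' eqs Δ (λ x → f (vs x)) (λ x → g (vs x))

  -- Sequents, theories and coherent (positive existential) provability
  -- (the sequent calculus of Johnstone, Elephant D1.3.1, restricted to
  --  positive existential formulas)

  record Sequent : Set where
    constructor [_⊢_⊣_]
    field
      ctx : Ctx
      lhs : Fm ctx
      rhs : Fm ctx

  Theory : Set₁
  Theory = Sequent → Set

  infix 3 _⊩_⇒_
  data _⊩_⇒_ (T : Theory) : ∀ {Γ} → Fm Γ → Fm Γ → Set where
    axiom  : ∀ {Γ φ ψ} → T [ Γ ⊢ φ ⊣ ψ ] → T ⊩ φ ⇒ ψ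
    idn    : ∀ {Γ} {φ : Fm Γ} → T ⊩ φ ⇒ φ
    cut    : ∀ {Γ} {φ ψ χ : Fm Γ} → T ⊩ φ ⇒ ψ → T ⊩ ψ ⇒ χ → T ⊩ φ ⇒ χ
    subst  : ∀ {Γ Δ} {φ ψ : Fm Δ} (σ : Sub Γ Δ) → T ⊩ φ ⇒ ψ → T ⊩ sub σ φ ⇒ sub σ ψ
    eq-refl  : ∀ {Γ A} (t : Tm Γ A) → T ⊩ ⊤' ⇒ t ≐ t
    eq-subst : ∀ {Γ A} (t u : Tm Γ A) (φ : Fm (A ∷ Γ)) →
               T ⊩ (t ≐ u) ∧' sub (sub0 t) φ ⇒ sub (sub0 u) φ
    top    : ∀ {Γ} {φ : Fm Γ} → T ⊩ φ ⇒ ⊤'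
    bot    : ∀ {Γ} {φ : Fm Γ} → T ⊩ ⊥' ⇒ φ
    ∧-intro : ∀ {Γ} {φ ψ χ : Fm Γ} → T ⊩ φ ⇒ ψ → T ⊩ φ ⇒ χ → T ⊩ φ ⇒ ψ ∧' χ
    ∧-elimˡ : ∀ {Γ} {ψ χ : Fm Γ} → T ⊩ ψ ∧' χ ⇒ ψ
    ∧-elimʳ : ∀ {Γ} {ψ χ : Fm Γ} → T ⊩ ψ ∧' χ ⇒ χ
    ∨-elim  : ∀ {Γ} {φ ψ χ : Fm Γ} → T ⊩ ψ ⇒ φ → T ⊩ χ ⇒ φ → T ⊩ ψ ∨' χ ⇒ φ
    ∨-introˡ : ∀ {Γ} {ψ χ : Fm Γ} → T ⊩ ψ ⇒ ψ ∨' χ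
    ∨-introʳ : ∀ {Γ} {ψ χ : Fm Γ} → T ⊩ χ ⇒ ψ ∨' χ
    ∃-elim  : ∀ {Γ A} {φ : Fm (A ∷ Γ)} {ψ : Fm Γ} → T ⊩ φ ⇒ wk ψ → T ⊩ ∃' φ ⇒ ψ
    ∃-intro : ∀ {Γ A} {φ : Fm (A ∷ Γ)} {ψ : Fm Γ} → T ⊩ ∃' φ ⇒ ψ → T ⊩ φ ⇒ wk ψ
    distrib : ∀ {Γ} {φ ψ χ : Fm Γ} → T ⊩ φ ∧' (ψ ∨' χ) ⇒ (φ ∧' ψ) ∨' (φ ∧' χ)
    frobenius : ∀ {Γ A} {φ : Fm Γ} {ψ : Fm (A ∷ Γ)} → T ⊩ φ ∧' ∃' ψ ⇒ ∃' (wk φ ∧' ψ)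

  record DSet : Set where
    constructor dset
    field
      ctx : Ctx
      fm  : Fm ctx

  module _ (T : Theory) where

    record DFun (X Y : DSet) : Set where
      open DSet X renaming (ctx to ΓX; fm to φ)
      open DSet Y renaming (ctx to ΓY; fm to ψ)
      field
        graph : Fm (ΓX ⧺ ΓY)
        typed : T ⊩ graph ⇒ ren (wkL ΓY) φ ∧' ren (wkR ΓX) ψ
        total : T ⊩ φ ⇒ ∃* ΓY graph
        functional :
          T ⊩ ren [ π₁ {ΓX} {ΓY} {ΓY} , π₂ {ΓX} {ΓY} {ΓY} ] graph
              ∧' ren [ π₁ {ΓX} {ΓY} {ΓY} , π₃ {ΓX} {ΓY} {ΓY} ] graph
            ⇒ eqs ΓY (π₂ {ΓX} {ΓY} {ΓY}) (π₃ {ΓX} {ΓY} {ΓY})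

    IsMono : ∀ {X Y} → DFun X Y → Set
    IsMono {dset ΓX φ} {dset ΓY ψ} f =
      T ⊩ ren [ π₁ {ΓX} {ΓX} {ΓY} , π₃ {ΓX} {ΓX} {ΓY} ] (DFun.graph f)
          ∧' ren [ π₂ {ΓX} {ΓX} {ΓY} , π₃ {ΓX} {ΓX} {ΓY} ] (DFun.graph f)
        ⇒ eqs ΓX (π₁ {ΓX} {ΓX} {ΓY}) (π₂ {ΓX} {ΓX} {ΓY})

    IsSurj : ∀ {X Y} → DFun X Y → Set
    IsSurj {dset ΓX φ} {dset ΓY ψ} f =
      T ⊩ ψ ⇒ ∃* ΓX (ren [ wkR ΓY , wkL ΓX ] (DFun.graph f))

    record DisjointCoproduct (X Y : DSet) : Set where
      open DSet X renaming (ctx to ΓX; fm to φ)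
      open DSet Y renaming (ctx to ΓY; fm to ψ)
      field
        Z    : DSet
        inj₁ : DFun X Z
        inj₂ : DFun Y Z
        mono₁ : IsMono inj₁
        mono₂ : IsMono inj₂
        disjoint :
          T ⊩ ren [ π₁ {ΓX} {ΓY} {DSet.ctx Z} , π₃ {ΓX} {ΓY} {DSet.ctx Z} ] (DFun.graph inj₁)
              ∧' ren [ π₂ {ΓX} {ΓY} {DSet.ctx Z} , π₃ {ΓX} {ΓY} {DSet.ctx Z} ] (DFun.graph inj₂)
            ⇒ ⊥'
        covering :
          T ⊩ DSet.fm Z ⇒ ∃* ΓX (ren [ wkR (DSet.ctx Z) , wkL ΓX ] (DFun.graph inj₁))
                         ∨' ∃* ΓY (ren [ wkR (DSet.ctx Z) , wkL ΓY ] (DFun.graph inj₂))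

    HasDisjointCoproducts : Set
    HasDisjointCoproducts = (X Y : DSet) → DisjointCoproduct X Y

    record DEquiv (X : DSet) : Set where
      open DSet X renaming (ctx to Γ; fm to φ)
      field
        E     : Fm (Γ ⧺ Γ)
        typed : T ⊩ E ⇒ ren (wkL Γ) φ ∧' ren (wkR Γ) φ
        refl  : T ⊩ φ ⇒ ren [ (λ x → x) , (λ x → x) ] E
        sym   : T ⊩ E ⇒ ren [ wkR Γ , wkL Γ ] E
        trans : T ⊩ ren [ π₁ {Γ} {Γ} {Γ} , π₂ {Γ} {Γ} {Γ} ] E ∧' ren [ π₂ {Γ} {Γ} {Γ} , π₃ {Γ} {Γ} {Γ} ] E
                  ⇒ ren [ π₁ {Γ} {Γ} {Γ} , π₃ {Γ} {Γ} {Γ} ] E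

    record Quotient {X : DSet} (E : DEquiv X) : Set where
      open DSet X renaming (ctx to Γ; fm to φ)
      field
        Y : DSet
        q : DFun X Y
        q-surj : IsSurj q
        q-effective₁ :
          T ⊩ DEquiv.E E ⇒ ∃* (DSet.ctx Y)
                (ren [ π₁ {Γ} {Γ} {DSet.ctx Y} , π₃ {Γ} {Γ} {DSet.ctx Y} ] (DFun.graph q)
                 ∧' ren [ π₂ {Γ} {Γ} {DSet.ctx Y} , π₃ {Γ} {Γ} {DSet.ctx Y} ] (DFun.graph q))
        q-effective₂ :
          T ⊩ ∃* (DSet.ctx Y)
                (ren [ π₁ {Γ} {Γ} {DSet.ctx Y} , π₃ {Γ} {Γ} {DSet.ctx Y} ] (DFun.graph q)
                 ∧' ren [ π₂ {Γ} {Γ} {DSet.ctx Y} , π₃ {Γ} {Γ} {DSet.ctx Y} ] (DFun.graph q))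
              ⇒ DEquiv.E E

    EliminatesImaginaries : Set
    EliminatesImaginaries = (X : DSet) (E : DEquiv X) → Quotient E

  Decidable : Theory → Set
  Decidable T = ∀ {Γ} (φ ψ : Fm Γ) → Dec (T ⊩ φ ⇒ ψ)

  -- Elimination of transitive closures
  -- A binary relation on the definable set of sort-tuples Γ is a formula in Γ ⧺ Γ.

  module _ {Γ : Ctx} where
    compose : Fm (Γ ⧺ Γ) → Fm (Γ ⧺ Γ) → Fm (Γ ⧺ Γ)
    compose ρ τ = ∃* Γ (ren [ x , z ] ρ ∧' ren [ z , y ] τ)
      where
        x y z : Ren ((Γ ⧺ Γ) ⧺ Γ) Γ
        x v = wkL Γ (wkL Γ v)
        y v = wkL Γ (wkR Γ v)
        z = wkR (Γ ⧺ Γ)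

    -- R^(k+1)
    power : Fm (Γ ⧺ Γ) → ℕ → Fm (Γ ⧺ Γ)
    power ρ zero    = ρ
    power ρ (suc k) = compose (power ρ k) ρ

    -- R ∨ R² ∨ ... ∨ R^(n+1)
    powersUpTo : Fm (Γ ⧺ Γ) → ℕ → Fm (Γ ⧺ Γ)
    powersUpTo ρ zero    = power ρ zero
    powersUpTo ρ (suc n) = powersUpTo ρ n ∨' power ρ (suc n)

  EliminatesTransitiveClosures : Theory → Set
  EliminatesTransitiveClosures T =
    ∀ {Γ} (ρ : Fm (Γ ⧺ Γ)) →
      ∃ λ n → T ⊩ compose {Γ} (powersUpTo {Γ} ρ n) (powersUpTo {Γ} ρ n) ⇒ powersUpTo {Γ} ρ n

  record Automaton (T : Theory) : Set where
    field
      -- alphabet Σ and states S (definable sets)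
      ΣC : Ctx
      α  : Fm ΣC
      SC : Ctx
      β  : Fm SC
      -- initial states I ↣ S and final states F ↣ S (definable subsets)
      ι   : Fm SC
      ι⊆S : T ⊩ ι ⇒ β
      fin   : Fm SC
      fin⊆S : T ⊩ fin ⇒ β
      σ      : Fm ((ΣC ⧺ SC) ⧺ SC)
      σ-typed : T ⊩ σ ⇒ ren (λ a → wkL SC (wkL SC a)) α
                          ∧' ren (λ s → wkL SC (wkR ΣC s)) β
                          ∧' ren (wkR (ΣC ⧺ SC)) β

    -- context of words of length n (a tuple of n letters)
    Words : ℕ → Ctx
    Words zero    = []
    Words (suc n) = Words n ⧺ ΣC

    letters : ∀ n → Fm (Words n)
    letters zero    = ⊤'
    letters (suc n) = ren (wkL ΣC) (letters n) ∧' ren (wkR (Words n)) α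

    -- σ̄ restricted to Σ^n : σ̄(ε) = id_S,  σ̄(w a) = σ̄(w) ; σ(a)
    σ̄ : ∀ n → Fm ((Words n ⧺ SC) ⧺ SC)
    σ̄ zero = eqs SC (λ s → wkL SC (wkR (Words zero) s)) (wkR (Words zero ⧺ SC))
             ∧' ren (λ s → wkL SC (wkR (Words zero) s)) β
    σ̄ (suc n) = ∃* SC (ren [ [ w , s ] , s' ] (σ̄ n) ∧' ren [ [ a , s' ] , s'' ] σ)
      where
        C : Ctx
        C = (((Words n ⧺ ΣC) ⧺ SC) ⧺ SC) ⧺ SC
        w : Ren C (Words n)
        w v = wkL SC (wkL SC (wkL SC (wkL ΣC v)))
        a : Ren C ΣC
        a v = wkL SC (wkL SC (wkL SC (wkR (Words n) v)))
        s : Ren C SC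
        s v = wkL SC (wkL SC (wkR (Words n ⧺ ΣC) v))
        s'' : Ren C SC
        s'' v = wkL SC (wkR ((Words n ⧺ ΣC) ⧺ SC) v)
        s' : Ren C SC
        s' = wkR ((((Words n ⧺ ΣC) ⧺ SC) ⧺ SC))

    -- L(A) ∩ Σ^n : words w of length n leading from an initial to a final state
    lang : ∀ n → Fm (Words n)
    lang n = letters n ∧'
      ∃* SC (∃* SC (ren (λ v → wkL SC (wkR (Words n) v)) ι
                    ∧' σ̄ n
                    ∧' ren (wkR (Words n ⧺ SC)) fin))

    -- L(A) is empty (as a subobject of Σ* = ∐ₙ Σⁿ)
    LanguageEmpty : Set
    LanguageEmpty = ∀ n → T ⊩ lang n ⇒ ⊥'

module Submission where

open import Defs
open import Data.List using ([]; _∷_)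
open import Data.Nat using (ℕ; zero; suc)
open import Data.Product using (_×_; _,_)
open import Function.Bundles using (_⇔_; mk⇔)
open import Relation.Nullary using (Dec)
open import Relation.Nullary.Decidable using (_×-dec_) renaming (map to map-dec)
open import Relation.Binary.PropositionalEquality using (_≡_; refl; sym; trans; cong; cong₂)

-- Let R(s, s') = ∃ a. σ(a, s, s') be the one-step reachability relation of the automaton and
-- P k = R^(k+1).  A run of length k + 1 moves along P k, and conversely P k(p, q) can be
-- refined into a run of length k + 1 from p to q.  Hence a nonempty word lies in L(A) iff some
-- power of R relates an initial state to a final state.  Elimination of transitive closures
-- gives N with R ∨ … ∨ R^(N+1) transitive; this relation then contains every power of R, so
-- L(A) is empty iff (i) the empty word is rejected and (ii) R ∨ … ∨ R^(N+1) relates no initial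
-- state to a final state.  Both conditions are single sequents, decided by the decidability of
-- T.

-- Substitution laws and copairing of renamings

module Syntax (Sg : Signature) where
  open Signature Sg
  open Logic Sg

  infixr 5 _∙_
  _∙_ : ∀ {a} {X : Set a} {x y z : X} → x ≡ y → y ≡ z → x ≡ z
  _∙_ = trans

  infix 4 _≗_
  _≗_ : ∀ {Γ Δ} → Sub Γ Δ → Sub Γ Δ → Set
  _≗_ {Γ} {Δ} σ τ = ∀ {A} (x : Var Δ A) → σ x ≡ τ x

  mutual
    subT-ext : ∀ {Γ Δ A} {σ τ : Sub Γ Δ} → σ ≗ τ → (t : Tm Δ A) → subT σ t ≡ subT τ t
    subT-ext e (var x)    = e x
    subT-ext e (app f ts) = cong (app f) (subTs-ext e ts)

    subTs-ext : ∀ {Γ Δ As} {σ τ : Sub Γ Δ} → σ ≗ τ → (ts : Tms Δ As) → subTs σ ts ≡ subTs τ ts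
    subTs-ext e []       = refl
    subTs-ext e (t ∷ ts) = cong₂ Tms._∷_ (subT-ext e t) (subTs-ext e ts)

  liftS-ext : ∀ {Γ Δ B} {σ τ : Sub Γ Δ} → σ ≗ τ → liftS {B = B} σ ≗ liftS τ
  liftS-ext e vz     = refl
  liftS-ext e (vs x) = cong (renT vs) (e x)

  sub-ext : ∀ {Γ Δ} {σ τ : Sub Γ Δ} → σ ≗ τ → (φ : Fm Δ) → sub σ φ ≡ sub τ φ
  sub-ext e ⊤'         = refl
  sub-ext e ⊥'         = refl
  sub-ext e (rel R ts) = cong (rel R) (subTs-ext e ts)
  sub-ext e (t ≐ u)    = cong₂ _≐_ (subT-ext e t) (subT-ext e u)
  sub-ext e (φ ∧' ψ)   = cong₂ _∧'_ (sub-ext e φ) (sub-ext e ψ)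
  sub-ext e (φ ∨' ψ)   = cong₂ _∨'_ (sub-ext e φ) (sub-ext e ψ)
  sub-ext e (∃' φ)     = cong ∃' (sub-ext (liftS-ext e) φ)

  mutual
    renT-sub : ∀ {Γ Δ A} (ρ : Ren Γ Δ) (t : Tm Δ A) → renT ρ t ≡ subT (λ x → var (ρ x)) t
    renT-sub ρ (var x)    = refl
    renT-sub ρ (app f ts) = cong (app f) (renTs-sub ρ ts)

    renTs-sub : ∀ {Γ Δ As} (ρ : Ren Γ Δ) (ts : Tms Δ As) → renTs ρ ts ≡ subTs (λ x → var (ρ x)) ts
    renTs-sub ρ []       = refl
    renTs-sub ρ (t ∷ ts) = cong₂ Tms._∷_ (renT-sub ρ t) (renTs-sub ρ ts)

  mutual
    subT-comp : ∀ {Γ Δ Θ A} (σ : Sub Γ Δ) (τ : Sub Δ Θ) (t : Tm Θ A) →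
                subT σ (subT τ t) ≡ subT (λ x → subT σ (τ x)) t
    subT-comp σ τ (var x)    = refl
    subT-comp σ τ (app f ts) = cong (app f) (subTs-comp σ τ ts)

    subTs-comp : ∀ {Γ Δ Θ As} (σ : Sub Γ Δ) (τ : Sub Δ Θ) (ts : Tms Θ As) →
                 subTs σ (subTs τ ts) ≡ subTs (λ x → subT σ (τ x)) ts
    subTs-comp σ τ []       = refl
    subTs-comp σ τ (t ∷ ts) = cong₂ Tms._∷_ (subT-comp σ τ t) (subTs-comp σ τ ts)

  mutual
    subT-id : ∀ {Γ A} (t : Tm Γ A) → subT var t ≡ t
    subT-id (var x)    = refl
    subT-id (app f ts) = cong (app f) (subTs-id ts)

    subTs-id : ∀ {Γ As} (ts : Tms Γ As) → subTs var ts ≡ ts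
    subTs-id []       = refl
    subTs-id (t ∷ ts) = cong₂ Tms._∷_ (subT-id t) (subTs-id ts)

  subT-renT : ∀ {Γ Δ Θ A} (σ : Sub Γ Δ) (ρ : Ren Δ Θ) (t : Tm Θ A) →
              subT σ (renT ρ t) ≡ subT (λ x → σ (ρ x)) t
  subT-renT σ ρ t = cong (subT σ) (renT-sub ρ t) ∙ subT-comp σ _ t

  renT-comp : ∀ {Γ Δ Θ A} (ρ : Ren Γ Δ) (ρ' : Ren Δ Θ) (t : Tm Θ A) →
              renT ρ (renT ρ' t) ≡ renT (λ x → ρ (ρ' x)) t
  renT-comp ρ ρ' t = renT-sub ρ _ ∙ subT-renT _ ρ' t ∙ sym (renT-sub _ t)

  liftS-comp : ∀ {Γ Δ Θ B} (σ : Sub Γ Δ) (τ : Sub Δ Θ) →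
               (λ {A} x → subT (liftS {B = B} σ) (liftS τ x)) ≗ liftS (λ x → subT σ (τ x))
  liftS-comp σ τ vz     = refl
  liftS-comp σ τ (vs x) =
    subT-renT (liftS σ) vs (τ x) ∙ subT-ext (λ y → renT-sub vs (σ y)) (τ x)
    ∙ sym (subT-comp _ σ (τ x)) ∙ sym (renT-sub vs _)

  sub-comp : ∀ {Γ Δ Θ} (σ : Sub Γ Δ) (τ : Sub Δ Θ) (φ : Fm Θ) →
             sub σ (sub τ φ) ≡ sub (λ x → subT σ (τ x)) φ
  sub-comp σ τ ⊤'         = refl
  sub-comp σ τ ⊥'         = refl
  sub-comp σ τ (rel R ts) = cong (rel R) (subTs-comp σ τ ts)
  sub-comp σ τ (t ≐ u)    = cong₂ _≐_ (subT-comp σ τ t) (subT-comp σ τ u)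
  sub-comp σ τ (φ ∧' ψ)   = cong₂ _∧'_ (sub-comp σ τ φ) (sub-comp σ τ ψ)
  sub-comp σ τ (φ ∨' ψ)   = cong₂ _∨'_ (sub-comp σ τ φ) (sub-comp σ τ ψ)
  sub-comp σ τ (∃' φ)     = cong ∃' (sub-comp (liftS σ) (liftS τ) φ ∙ sub-ext (liftS-comp σ τ) φ)

  liftS-var : ∀ {Γ B} → liftS {B = B} (var {Γ}) ≗ var
  liftS-var vz     = refl
  liftS-var (vs x) = refl

  sub-id : ∀ {Γ} (φ : Fm Γ) → sub var φ ≡ φ
  sub-id ⊤'         = refl
  sub-id ⊥'         = refl
  sub-id (rel R ts) = cong (rel R) (subTs-id ts)
  sub-id (t ≐ u)    = cong₂ _≐_ (subT-id t) (subT-id u)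
  sub-id (φ ∧' ψ)   = cong₂ _∧'_ (sub-id φ) (sub-id ψ)
  sub-id (φ ∨' ψ)   = cong₂ _∨'_ (sub-id φ) (sub-id ψ)
  sub-id (∃' φ)     = cong ∃' (sub-ext liftS-var φ ∙ sub-id φ)

  ren-ext : ∀ {Γ Δ} {ρ ρ' : Ren Γ Δ} → (∀ {A} (x : Var Δ A) → ρ x ≡ ρ' x) →
            (φ : Fm Δ) → ren ρ φ ≡ ren ρ' φ
  ren-ext e = sub-ext (λ x → cong var (e x))

  ren-ren : ∀ {Γ Δ Θ} (ρ : Ren Γ Δ) (ρ' : Ren Δ Θ) (φ : Fm Θ) →
            ren ρ (ren ρ' φ) ≡ ren (λ x → ρ (ρ' x)) φ
  ren-ren ρ ρ' φ = sub-comp _ _ φ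

  ⧺-ext : ∀ {F : Sort → Set} {Γ} Δ (h k : ∀ {A} → Var (Γ ⧺ Δ) A → F A) →
          (∀ {A} (y : Var Γ A) → h (wkL Δ y) ≡ k (wkL Δ y)) →
          (∀ {A} (y : Var Δ A) → h (wkR Γ y) ≡ k (wkR Γ y)) →
          ∀ {A} (x : Var (Γ ⧺ Δ) A) → h x ≡ k x
  ⧺-ext []      h k l r x      = l x
  ⧺-ext (B ∷ Δ) h k l r vz     = r vz
  ⧺-ext (B ∷ Δ) h k l r (vs x) = ⧺-ext Δ (λ y → h (vs y)) (λ y → k (vs y)) l (λ y → r (vs y)) x

  [,]-wkL : ∀ {Γ Δ Θ} (f : Ren Θ Γ) (g : Ren Θ Δ) {A} (x : Var Γ A) →
            [_,_] {Γ} {Δ} f g (wkL Δ x) ≡ f x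
  [,]-wkL {Δ = []}    f g x = refl
  [,]-wkL {Δ = B ∷ Δ} f g x = [,]-wkL {Δ = Δ} f (λ y → g (vs y)) x

  [,]-wkR : ∀ {Γ Δ Θ} (f : Ren Θ Γ) (g : Ren Θ Δ) {A} (x : Var Δ A) →
            [_,_] {Γ} {Δ} f g (wkR Γ x) ≡ g x
  [,]-wkR {Δ = B ∷ Δ} f g vz     = refl
  [,]-wkR {Δ = B ∷ Δ} f g (vs x) = [,]-wkR {Δ = Δ} f (λ y → g (vs y)) x

  [,]-unique : ∀ {Θ Γ Δ} (ρ : Ren Θ (Γ ⧺ Δ)) (f : Ren Θ Γ) (g : Ren Θ Δ) →
               (∀ {A} (v : Var Γ A) → ρ (wkL Δ v) ≡ f v) →
               (∀ {A} (v : Var Δ A) → ρ (wkR Γ v) ≡ g v) →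
               ∀ {A} (x : Var (Γ ⧺ Δ) A) → ρ x ≡ [_,_] {Γ} {Δ} f g x
  [,]-unique {Γ = Γ} {Δ} ρ f g l r = ⧺-ext Δ ρ ([_,_] {Γ} {Δ} f g)
    (λ v → l v ∙ sym ([,]-wkL {Δ = Δ} f g v)) (λ v → r v ∙ sym ([,]-wkR {Δ = Δ} f g v))

  ⟨_,_,_⟩ : ∀ {Θ Γ₁ Γ₂ Γ₃} → Ren Θ Γ₁ → Ren Θ Γ₂ → Ren Θ Γ₃ → Ren Θ ((Γ₁ ⧺ Γ₂) ⧺ Γ₃)
  ⟨_,_,_⟩ {Γ₁ = Γ₁} {Γ₂} {Γ₃} f g h = [_,_] {Γ₁ ⧺ Γ₂} {Γ₃} ([_,_] {Γ₁} {Γ₂} f g) h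

  module _ {Θ Γ₁ Γ₂ Γ₃} (f : Ren Θ Γ₁) (g : Ren Θ Γ₂) (h : Ren Θ Γ₃) where
    ⟨⟩-π₁ : ∀ {A} (v : Var Γ₁ A) → ⟨ f , g , h ⟩ (wkL Γ₃ (wkL Γ₂ v)) ≡ f v
    ⟨⟩-π₁ v = [,]-wkL {Δ = Γ₃} _ h _ ∙ [,]-wkL {Δ = Γ₂} f g v

    ⟨⟩-π₂ : ∀ {A} (v : Var Γ₂ A) → ⟨ f , g , h ⟩ (wkL Γ₃ (wkR Γ₁ v)) ≡ g v
    ⟨⟩-π₂ v = [,]-wkL {Δ = Γ₃} _ h _ ∙ [,]-wkR {Δ = Γ₂} f g v

    ⟨⟩-π₃ : ∀ {A} (v : Var Γ₃ A) → ⟨ f , g , h ⟩ (wkR (Γ₁ ⧺ Γ₂) v) ≡ h v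
    ⟨⟩-π₃ v = [,]-wkR {Δ = Γ₃} _ h v

    ⟨⟩-unique : (ρ : Ren Θ ((Γ₁ ⧺ Γ₂) ⧺ Γ₃)) →
                (∀ {A} (v : Var Γ₁ A) → ρ (wkL Γ₃ (wkL Γ₂ v)) ≡ f v) →
                (∀ {A} (v : Var Γ₂ A) → ρ (wkL Γ₃ (wkR Γ₁ v)) ≡ g v) →
                (∀ {A} (v : Var Γ₃ A) → ρ (wkR (Γ₁ ⧺ Γ₂) v) ≡ h v) →
                ∀ {A} (x : Var ((Γ₁ ⧺ Γ₂) ⧺ Γ₃) A) → ρ x ≡ ⟨ f , g , h ⟩ x
    ⟨⟩-unique ρ l m r =
      ⧺-ext Γ₃ ρ ⟨ f , g , h ⟩
        (⧺-ext Γ₂ (λ y → ρ (wkL Γ₃ y)) (λ y → ⟨ f , g , h ⟩ (wkL Γ₃ y))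
           (λ v → l v ∙ sym (⟨⟩-π₁ v)) (λ v → m v ∙ sym (⟨⟩-π₂ v)))
        (λ v → r v ∙ sym (⟨⟩-π₃ v))

  ren²-[,] : ∀ {Θ Θ' Γ Δ} (ρ : Ren Θ Θ') (ρ' : Ren Θ' (Γ ⧺ Δ)) (f : Ren Θ Γ) (g : Ren Θ Δ) →
             (∀ {A} (v : Var Γ A) → ρ (ρ' (wkL Δ v)) ≡ f v) →
             (∀ {A} (v : Var Δ A) → ρ (ρ' (wkR Γ v)) ≡ g v) →
             (φ : Fm (Γ ⧺ Δ)) → ren ρ (ren ρ' φ) ≡ ren ([_,_] {Γ} {Δ} f g) φ
  ren²-[,] ρ ρ' f g l r φ = ren-ren ρ ρ' φ ∙ ren-ext ([,]-unique (λ x → ρ (ρ' x)) f g l r) φ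

  ren²-⟨⟩ : ∀ {Θ Θ' Γ₁ Γ₂ Γ₃} (ρ : Ren Θ Θ') (ρ' : Ren Θ' ((Γ₁ ⧺ Γ₂) ⧺ Γ₃))
            (f : Ren Θ Γ₁) (g : Ren Θ Γ₂) (h : Ren Θ Γ₃) →
            (∀ {A} (v : Var Γ₁ A) → ρ (ρ' (wkL Γ₃ (wkL Γ₂ v))) ≡ f v) →
            (∀ {A} (v : Var Γ₂ A) → ρ (ρ' (wkL Γ₃ (wkR Γ₁ v))) ≡ g v) →
            (∀ {A} (v : Var Γ₃ A) → ρ (ρ' (wkR (Γ₁ ⧺ Γ₂) v)) ≡ h v) →
            (φ : Fm ((Γ₁ ⧺ Γ₂) ⧺ Γ₃)) → ren ρ (ren ρ' φ) ≡ ren ⟨ f , g , h ⟩ φ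
  ren²-⟨⟩ ρ ρ' f g h l m r φ = ren-ren ρ ρ' φ ∙ ren-ext (⟨⟩-unique f g h (λ x → ρ (ρ' x)) l m r) φ

  ren-[,]-wkL : ∀ {Θ Γ Δ} (f : Ren Θ Γ) (g : Ren Θ Δ) (φ : Fm Γ) →
                ren ([_,_] {Γ} {Δ} f g) (ren (wkL Δ) φ) ≡ ren f φ
  ren-[,]-wkL {Δ = Δ} f g φ = ren-ren _ (wkL Δ) φ ∙ ren-ext ([,]-wkL {Δ = Δ} f g) φ

  ren-[,]-wkR : ∀ {Θ Γ Δ} (f : Ren Θ Γ) (g : Ren Θ Δ) (φ : Fm Δ) →
                ren ([_,_] {Γ} {Δ} f g) (ren (wkR Γ) φ) ≡ ren g φ
  ren-[,]-wkR {Γ = Γ} {Δ} f g φ = ren-ren _ (wkR Γ) φ ∙ ren-ext ([,]-wkR {Δ = Δ} f g) φ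

  ren-[,]-η : ∀ {Γ Δ} (φ : Fm (Γ ⧺ Δ)) → ren ([_,_] {Γ} {Δ} (wkL Δ) (wkR Γ)) φ ≡ φ
  ren-[,]-η {Γ} {Δ} φ =
    ren-ext (λ x → sym ([,]-unique {Γ = Γ} {Δ} (λ x → x) (wkL Δ) (wkR Γ) (λ _ → refl) (λ _ → refl) x)) φ
    ∙ sub-id φ

  ren-[,]-comp : ∀ {Θ Θ' Γ Δ} (ρ : Ren Θ Θ') (f : Ren Θ' Γ) (g : Ren Θ' Δ) (φ : Fm (Γ ⧺ Δ)) →
                 ren ρ (ren ([_,_] {Γ} {Δ} f g) φ) ≡ ren ([_,_] {Γ} {Δ} (λ v → ρ (f v)) (λ v → ρ (g v))) φ
  ren-[,]-comp {Δ = Δ} ρ f g = ren²-[,] ρ _ _ _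
    (λ v → cong ρ ([,]-wkL {Δ = Δ} f g v)) (λ v → cong ρ ([,]-wkR {Δ = Δ} f g v))

  module _ {Θ Γ₁ Γ₂ Γ₃} (f : Ren Θ Γ₁) (g : Ren Θ Γ₂) (h : Ren Θ Γ₃) where
    ren-⟨⟩-π₁ : (φ : Fm Γ₁) → ren ⟨ f , g , h ⟩ (ren (λ v → wkL Γ₃ (wkL Γ₂ v)) φ) ≡ ren f φ
    ren-⟨⟩-π₁ φ = ren-ren _ _ φ ∙ ren-ext (⟨⟩-π₁ f g h) φ

    ren-⟨⟩-π₂ : (φ : Fm Γ₂) → ren ⟨ f , g , h ⟩ (ren (λ v → wkL Γ₃ (wkR Γ₁ v)) φ) ≡ ren g φ
    ren-⟨⟩-π₂ φ = ren-ren _ _ φ ∙ ren-ext (⟨⟩-π₂ f g h) φ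

    ren-⟨⟩-π₃ : (φ : Fm Γ₃) → ren ⟨ f , g , h ⟩ (ren (wkR (Γ₁ ⧺ Γ₂)) φ) ≡ ren h φ
    ren-⟨⟩-π₃ φ = ren-ren _ _ φ ∙ ren-ext (⟨⟩-π₃ f g h) φ

    ren-⟨⟩-comp : ∀ {Θ'} (ρ : Ren Θ' Θ) (φ : Fm ((Γ₁ ⧺ Γ₂) ⧺ Γ₃)) →
                  ren ρ (ren ⟨ f , g , h ⟩ φ) ≡ ren ⟨ (λ v → ρ (f v)) , (λ v → ρ (g v)) , (λ v → ρ (h v)) ⟩ φ
    ren-⟨⟩-comp ρ = ren²-⟨⟩ ρ _ _ _ _
      (λ v → cong ρ (⟨⟩-π₁ f g h v))
      (λ v → cong ρ (⟨⟩-π₂ f g h v))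
      (λ v → cong ρ (⟨⟩-π₃ f g h v))

  _◂_ : ∀ {Θ Δ B} → Var Θ B → Ren Θ Δ → Ren Θ (B ∷ Δ)
  (x ◂ h) vz     = x
  (x ◂ h) (vs y) = h y

  fix-first : ∀ {Θ B} Δ → Var Θ B → Ren (Θ ⧺ Δ) (B ∷ Δ)
  fix-first Δ x vz          = wkL Δ x
  fix-first {Θ} Δ x (vs y) = wkR Θ y

  ren-fix-first : ∀ {Θ B} Δ (x : Var Θ B) (h : Ren Θ Δ) (χ : Fm (Θ ⧺ (B ∷ Δ))) →
                  ren ([_,_] {Θ} {Δ} (λ v → v) h) (ren ([_,_] {Θ} {B ∷ Δ} (wkL Δ) (fix-first Δ x)) χ)
                  ≡ ren ([_,_] {Θ} {B ∷ Δ} (λ v → v) (x ◂ h)) χ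
  ren-fix-first {Θ} Δ x h χ = ren²-[,] id⟨h⟩ _ (λ v → v) (x ◂ h)
      (λ y → cong id⟨h⟩ ([,]-wkL {Δ = _ ∷ Δ} (wkL Δ) (fix-first Δ x) y) ∙ [,]-wkL {Δ = Δ} (λ v → v) h y)
      (λ y → cong id⟨h⟩ ([,]-wkR {Δ = _ ∷ Δ} (wkL Δ) (fix-first Δ x) y) ∙ on-block y) χ
    where
      id⟨h⟩ : Ren Θ (Θ ⧺ Δ)
      id⟨h⟩ = [_,_] {Θ} {Δ} (λ v → v) h
      on-block : ∀ {A} (y : Var (_ ∷ Δ) A) → id⟨h⟩ (fix-first Δ x y) ≡ (x ◂ h) y
      on-block vz     = [,]-wkL {Δ = Δ} (λ v → v) h x
      on-block (vs y) = [,]-wkR {Δ = Δ} (λ v → v) h y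

  liftS* : ∀ {Γ Θ} Δ → Sub Γ Θ → Sub (Γ ⧺ Δ) (Θ ⧺ Δ)
  liftS* []      σ = σ
  liftS* (B ∷ Δ) σ = liftS (liftS* Δ σ)

  liftS*-wkL : ∀ {Γ Θ} Δ (σ : Sub Γ Θ) {A} (x : Var Θ A) →
               liftS* Δ σ (wkL Δ x) ≡ renT (wkL Δ) (σ x)
  liftS*-wkL []      σ x = sym (renT-sub _ (σ x) ∙ subT-id (σ x))
  liftS*-wkL (B ∷ Δ) σ x = cong (renT vs) (liftS*-wkL Δ σ x) ∙ renT-comp vs (wkL Δ) (σ x)

  liftS*-wkR : ∀ {Γ Θ} Δ (σ : Sub Γ Θ) {A} (x : Var Δ A) → liftS* Δ σ (wkR Θ x) ≡ var (wkR Γ x)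
  liftS*-wkR (B ∷ Δ) σ vz     = refl
  liftS*-wkR (B ∷ Δ) σ (vs x) = cong (renT vs) (liftS*-wkR Δ σ x)

  sub-∃* : ∀ {Γ Θ} Δ (σ : Sub Γ Θ) (φ : Fm (Θ ⧺ Δ)) → sub σ (∃* Δ φ) ≡ ∃* Δ (sub (liftS* Δ σ) φ)
  sub-∃* []      σ φ = refl
  sub-∃* (B ∷ Δ) σ φ = sub-∃* Δ σ (∃' φ)

  ren-∃* : ∀ {Γ Θ} Δ (η : Ren Γ Θ) (φ : Fm (Θ ⧺ Δ)) →
           ren η (∃* Δ φ) ≡ ∃* Δ (ren ([_,_] {Θ} {Δ} (λ y → wkL Δ (η y)) (wkR Γ)) φ)
  ren-∃* {Γ} {Θ} Δ η φ = sub-∃* Δ _ φ ∙ cong (∃* Δ) (sub-ext lifted φ)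
    where
      lifted : liftS* Δ (λ x → var (η x)) ≗ (λ x → var ([_,_] {Θ} {Δ} (λ y → wkL Δ (η y)) (wkR Γ) x))
      lifted = ⧺-ext {F = Tm (Γ ⧺ Δ)} Δ (liftS* Δ (λ x → var (η x))) _
        (λ y → liftS*-wkL Δ (λ x → var (η x)) y
               ∙ cong var (sym ([,]-wkL {Δ = Δ} (λ y → wkL Δ (η y)) (wkR Γ) y)))
        (λ y → liftS*-wkR Δ (λ x → var (η x)) y
               ∙ cong var (sym ([,]-wkR {Δ = Δ} (λ y → wkL Δ (η y)) (wkR Γ) y)))

-- Derived rules of positive existential logic

module Derivations (Sg : Signature) (T : Logic.Theory Sg) where
  open Signature Sg
  open Logic Sg
  open Syntax Sg

  cast : ∀ {Γ} {φ φ' ψ ψ' : Fm Γ} → φ ≡ φ' → ψ ≡ ψ' → T ⊩ φ ⇒ ψ → T ⊩ φ' ⇒ ψ'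
  cast refl refl p = p

  infixl 4 _⨾_
  _⨾_ : ∀ {Γ} {φ ψ χ : Fm Γ} → T ⊩ φ ⇒ ψ → T ⊩ ψ ⇒ χ → T ⊩ φ ⇒ χ
  _⨾_ = cut

  rename : ∀ {Γ Δ} (ρ : Ren Γ Δ) {φ ψ : Fm Δ} → T ⊩ φ ⇒ ψ → T ⊩ ren ρ φ ⇒ ren ρ ψ
  rename ρ = subst (λ x → var (ρ x))

  ∧-map : ∀ {Γ} {φ φ' ψ ψ' : Fm Γ} → T ⊩ φ ⇒ φ' → T ⊩ ψ ⇒ ψ' → T ⊩ φ ∧' ψ ⇒ φ' ∧' ψ'
  ∧-map p q = ∧-intro (∧-elimˡ ⨾ p) (∧-elimʳ ⨾ q)

  ∃*-intro : ∀ {Θ Γ} Δ (ψ : Fm (Γ ⧺ Δ)) (θ : Sub Θ (Γ ⧺ Δ)) →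
             T ⊩ sub θ ψ ⇒ sub (λ x → θ (wkL Δ x)) (∃* Δ ψ)
  ∃*-intro []      ψ θ = idn
  ∃*-intro (B ∷ Δ) ψ θ =
    cast refl (sub-comp θ _ (∃' ψ)) (subst θ (∃-intro idn)) ⨾ ∃*-intro Δ (∃' ψ) (λ x → θ (vs x))

  ∃*-elim : ∀ {Γ} Δ {φ : Fm (Γ ⧺ Δ)} {χ : Fm Γ} → T ⊩ φ ⇒ ren (wkL Δ) χ → T ⊩ ∃* Δ φ ⇒ χ
  ∃*-elim []      {χ = χ} p = cast refl (sub-id χ) p
  ∃*-elim (B ∷ Δ) {χ = χ} p = ∃*-elim Δ (∃-elim (cast refl (sym (ren-ren vs (wkL Δ) χ)) p))

  ∃*-unit : ∀ {Γ} Δ (ψ : Fm (Γ ⧺ Δ)) → T ⊩ ψ ⇒ ren (wkL Δ) (∃* Δ ψ)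
  ∃*-unit Δ ψ = cast (sub-id ψ) refl (∃*-intro Δ ψ var)

  ∃*-map : ∀ {Γ} Δ {φ ψ : Fm (Γ ⧺ Δ)} → T ⊩ φ ⇒ ψ → T ⊩ ∃* Δ φ ⇒ ∃* Δ ψ
  ∃*-map Δ {ψ = ψ} p = ∃*-elim Δ (p ⨾ ∃*-unit Δ ψ)

  ∃*-frobenius : ∀ {Γ} Δ (φ : Fm Γ) (ψ : Fm (Γ ⧺ Δ)) → T ⊩ φ ∧' ∃* Δ ψ ⇒ ∃* Δ (ren (wkL Δ) φ ∧' ψ)
  ∃*-frobenius []      φ ψ = cast refl (cong (_∧' ψ) (sym (sub-id φ))) idn
  ∃*-frobenius (C ∷ Δ) φ ψ =
    ∃*-frobenius Δ φ (∃' ψ)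
    ⨾ cast refl (cong (λ φ' → ∃* Δ (∃' (φ' ∧' ψ))) (ren-ren vs (wkL Δ) φ)) (∃*-map Δ frobenius)

  ∃*-witness : ∀ {Θ Γ} Δ (ψ : Fm (Γ ⧺ Δ)) (η : Ren Θ Γ) (δ : Ren Θ Δ) {H : Fm Θ} →
               T ⊩ H ⇒ ren ([_,_] {Γ} {Δ} η δ) ψ → T ⊩ H ⇒ ren η (∃* Δ ψ)
  ∃*-witness {Θ} {Γ} Δ ψ η δ p =
    cast refl (sym (ren-∃* Δ η ψ)) (p ⨾ cast instance-eq closed-eq (∃*-intro Δ ψ' θ))
    where
      ψ' : Fm (Θ ⧺ Δ)
      ψ' = ren ([_,_] {Γ} {Δ} (λ y → wkL Δ (η y)) (wkR Θ)) ψ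
      θ : Sub Θ (Θ ⧺ Δ)
      θ x = var ([_,_] {Θ} {Δ} (λ x → x) δ x)
      instance-eq : sub θ ψ' ≡ ren ([_,_] {Γ} {Δ} η δ) ψ
      instance-eq = ren²-[,] ([_,_] {Θ} {Δ} (λ x → x) δ) _ η δ
        (λ y → cong ([_,_] {Θ} {Δ} (λ x → x) δ) ([,]-wkL {Δ = Δ} _ (wkR Θ) y)
               ∙ [,]-wkL {Δ = Δ} (λ x → x) δ (η y))
        (λ y → cong ([_,_] {Θ} {Δ} (λ x → x) δ) ([,]-wkR {Δ = Δ} (λ y → wkL Δ (η y)) (wkR Θ) y)
               ∙ [,]-wkR {Δ = Δ} (λ x → x) δ y) ψ
      closed-eq : sub (λ x → θ (wkL Δ x)) (∃* Δ ψ') ≡ ∃* Δ ψ'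
      closed-eq = sub-ext (λ x → cong var ([,]-wkL {Δ = Δ} (λ x → x) δ x)) _ ∙ sub-id _

  eqs-ren : ∀ {Γ Θ} Δ (ρ : Ren Γ Θ) (f g : Ren Θ Δ) →
            ren ρ (eqs Δ f g) ≡ eqs Δ (λ x → ρ (f x)) (λ x → ρ (g x))
  eqs-ren []      ρ f g = refl
  eqs-ren (B ∷ Δ) ρ f g =
    cong (var (ρ (f vz)) ≐ var (ρ (g vz)) ∧'_) (eqs-ren Δ ρ (λ x → f (vs x)) (λ x → g (vs x)))

  eqs-ext : ∀ {Θ} Δ {f f' g g' : Ren Θ Δ} → (∀ {A} (x : Var Δ A) → f x ≡ f' x) →
            (∀ {A} (x : Var Δ A) → g x ≡ g' x) → eqs Δ f g ≡ eqs Δ f' g'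
  eqs-ext []      ef eg = refl
  eqs-ext (B ∷ Δ) ef eg = cong₂ _∧'_ (cong₂ (λ x y → var x ≐ var y) (ef vz) (eg vz))
                                     (eqs-ext Δ (λ x → ef (vs x)) (λ x → eg (vs x)))

  eqs-refl : ∀ {Θ} Δ (f : Ren Θ Δ) {φ : Fm Θ} → T ⊩ φ ⇒ eqs Δ f f
  eqs-refl []      f = top
  eqs-refl (B ∷ Δ) f = ∧-intro (top ⨾ eq-refl _) (eqs-refl Δ (λ x → f (vs x)))

  eq-sym : ∀ {Γ A} (t u : Tm Γ A) → T ⊩ t ≐ u ⇒ u ≐ t
  eq-sym t u = ∧-intro idn (top ⨾ cast refl (cong (t ≐_) (sym (closed t))) (eq-refl t))
               ⨾ cast refl (cong (u ≐_) (closed u)) (eq-subst t u (var vz ≐ renT vs t))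
    where
      closed : ∀ s → subT (sub0 s) (renT vs t) ≡ t
      closed s = subT-renT (sub0 s) vs t ∙ subT-id t

  eqs-sym : ∀ {Θ} Δ (f g : Ren Θ Δ) → T ⊩ eqs Δ f g ⇒ eqs Δ g f
  eqs-sym []      f g = idn
  eqs-sym (B ∷ Δ) f g = ∧-map (eq-sym _ _) (eqs-sym Δ (λ x → f (vs x)) (λ x → g (vs x)))

  -- substitution of equal tuples: the tuple version of the rule eq-subst, proved by
  -- rewriting the first variable and recursing on the rest of the tuple
  eqs-subst : ∀ {Θ} Δ (f g : Ren Θ Δ) (χ : Fm (Θ ⧺ Δ)) →
              T ⊩ eqs Δ f g ∧' ren ([_,_] {Θ} {Δ} (λ x → x) f) χ ⇒ ren ([_,_] {Θ} {Δ} (λ x → x) g) χ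
  eqs-subst []      f g χ = ∧-elimʳ
  eqs-subst {Θ} (B ∷ Δ) f g χ =
    ∧-intro (∧-elimˡ ⨾ ∧-elimʳ) (∧-intro (∧-elimˡ ⨾ ∧-elimˡ) ∧-elimʳ ⨾ head)
    ⨾ cast refl (ren-fix-first Δ (g vz) g' χ ∙ ren-ext (λ { vz → refl ; (vs y) → refl }) χ)
           (eqs-subst Δ f' g' (ren ([_,_] {Θ} {B ∷ Δ} (wkL Δ) (fix-first Δ (g vz))) χ))
    where
      f' g' : Ren Θ Δ
      f' x = f (vs x)
      g' x = g (vs x)
      -- χ as a formula in its first variable, the others instantiated by f'
      φ : Fm (B ∷ Θ)
      φ = sub (liftS (λ x → var ([_,_] {Θ} {Δ} (λ y → y) f' x))) χ
      head : T ⊩ (var (f vz) ≐ var (g vz)) ∧' ren ([_,_] {Θ} {B ∷ Δ} (λ x → x) f) χ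
               ⇒ ren ([_,_] {Θ} {Δ} (λ x → x) f') (ren ([_,_] {Θ} {B ∷ Δ} (wkL Δ) (fix-first Δ (g vz))) χ)
      head = cast (cong (_ ∧'_) (sub-comp _ _ χ ∙ sub-ext (λ { vz → refl ; (vs y) → refl }) χ))
                  (sub-comp _ _ χ ∙ sub-ext (λ { vz → refl ; (vs y) → refl }) χ
                   ∙ sym (ren-fix-first Δ (g vz) f' χ))
                  (eq-subst (var (f vz)) (var (g vz)) φ)

-- Composition and powers of definable binary relations

module Relations (Sg : Signature) (T : Logic.Theory Sg) {Γ : Logic.Ctx Sg} where
  open Logic Sg
  open Syntax Sg
  open Derivations Sg T

  ⟦_,_⟧ : ∀ {Θ} → Ren Θ Γ → Ren Θ Γ → Ren Θ (Γ ⧺ Γ)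
  ⟦ p , q ⟧ = [_,_] {Γ} {Γ} p q

  compose-at : ∀ {Θ} (p q : Ren Θ Γ) (ρ τ : Fm (Γ ⧺ Γ)) →
    ren ⟦ p , q ⟧ (compose {Γ} ρ τ) ≡
    ∃* Γ (ren ⟦ (λ v → wkL Γ (p v)) , wkR Θ ⟧ ρ ∧' ren ⟦ wkR Θ , (λ v → wkL Γ (q v)) ⟧ τ)
  compose-at {Θ} p q ρ τ = ren-∃* Γ ⟦ p , q ⟧ _ ∙ cong (∃* Γ) (cong₂ _∧'_
      (ren²-[,] ν ⟦ x , z ⟧ _ (wkR Θ) (λ v → cong ν ([,]-wkL {Δ = Γ} x z v) ∙ outer-wkL v)
                                     (λ v → cong ν ([,]-wkR {Δ = Γ} x z v) ∙ middle v) ρ)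
      (ren²-[,] ν ⟦ z , y ⟧ (wkR Θ) _ (λ v → cong ν ([,]-wkL {Δ = Γ} z y v) ∙ middle v)
                                     (λ v → cong ν ([,]-wkR {Δ = Γ} z y v) ∙ outer-wkR v) τ))
    where
      ν : Ren (Θ ⧺ Γ) ((Γ ⧺ Γ) ⧺ Γ)
      ν = [_,_] {Γ ⧺ Γ} {Γ} (λ y → wkL Γ (⟦ p , q ⟧ y)) (wkR Θ)
      x y z : Ren ((Γ ⧺ Γ) ⧺ Γ) Γ
      x v = wkL Γ (wkL Γ v)
      y v = wkL Γ (wkR Γ v)
      z = wkR (Γ ⧺ Γ)
      middle : ∀ {A} (v : Var Γ A) → ν (z v) ≡ wkR Θ v
      middle v = [,]-wkR {Δ = Γ} _ (wkR Θ) v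
      outer-wkL : ∀ {A} (v : Var Γ A) → ν (wkL Γ (wkL Γ v)) ≡ wkL Γ (p v)
      outer-wkL v = [,]-wkL {Δ = Γ} _ (wkR Θ) (wkL Γ v) ∙ cong (wkL Γ) ([,]-wkL {Δ = Γ} p q v)
      outer-wkR : ∀ {A} (v : Var Γ A) → ν (wkL Γ (wkR Γ v)) ≡ wkL Γ (q v)
      outer-wkR v = [,]-wkL {Δ = Γ} _ (wkR Θ) (wkR Γ v) ∙ cong (wkL Γ) ([,]-wkR {Δ = Γ} p q v)

  compose-intro : ∀ {Θ} (p z q : Ren Θ Γ) (ρ τ : Fm (Γ ⧺ Γ)) →
                  T ⊩ ren ⟦ p , z ⟧ ρ ∧' ren ⟦ z , q ⟧ τ ⇒ ren ⟦ p , q ⟧ (compose {Γ} ρ τ)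
  compose-intro p z q ρ τ =
    ∃*-witness Γ (ren ⟦ x , m ⟧ ρ ∧' ren ⟦ m , y ⟧ τ) ⟦ p , q ⟧ z (cast refl (sym instance-eq) idn)
    where
      x y m : Ren ((Γ ⧺ Γ) ⧺ Γ) Γ
      x v = wkL Γ (wkL Γ v)
      y v = wkL Γ (wkR Γ v)
      m = wkR (Γ ⧺ Γ)
      pqz = ⟨ p , q , z ⟩
      instance-eq : ren pqz (ren ⟦ x , m ⟧ ρ ∧' ren ⟦ m , y ⟧ τ) ≡ ren ⟦ p , z ⟧ ρ ∧' ren ⟦ z , q ⟧ τ
      instance-eq = cong₂ _∧'_
        (ren²-[,] pqz ⟦ x , m ⟧ p z (λ v → cong pqz ([,]-wkL {Δ = Γ} x m v) ∙ ⟨⟩-π₁ p q z v)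
                                    (λ v → cong pqz ([,]-wkR {Δ = Γ} x m v) ∙ ⟨⟩-π₃ p q z v) ρ)
        (ren²-[,] pqz ⟦ m , y ⟧ z q (λ v → cong pqz ([,]-wkL {Δ = Γ} m y v) ∙ ⟨⟩-π₃ p q z v)
                                    (λ v → cong pqz ([,]-wkR {Δ = Γ} m y v) ∙ ⟨⟩-π₂ p q z v) τ)

  compose-elim : ∀ {Θ} (p q : Ren Θ Γ) (ρ τ : Fm (Γ ⧺ Γ)) (K χ : Fm Θ) →
                 T ⊩ ren (wkL Γ) K ∧' ren ⟦ (λ v → wkL Γ (p v)) , wkR Θ ⟧ ρ
                                   ∧' ren ⟦ wkR Θ , (λ v → wkL Γ (q v)) ⟧ τ ⇒ ren (wkL Γ) χ →
                 T ⊩ K ∧' ren ⟦ p , q ⟧ (compose {Γ} ρ τ) ⇒ χ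
  compose-elim p q ρ τ K χ h =
    cast (cong (K ∧'_) (sym (compose-at p q ρ τ))) refl (∃*-frobenius Γ K _ ⨾ ∃*-elim Γ h)

  compose-mono : ∀ {ρ ρ' τ τ' : Fm (Γ ⧺ Γ)} → T ⊩ ρ ⇒ ρ' → T ⊩ τ ⇒ τ' →
                 T ⊩ compose {Γ} ρ τ ⇒ compose {Γ} ρ' τ'
  compose-mono p q = ∃*-map Γ (∧-map (rename _ p) (rename _ q))

  module _ (ρ : Fm (Γ ⧺ Γ)) where

    ≤-powersUpTo : ∀ n → T ⊩ ρ ⇒ powersUpTo {Γ} ρ n
    ≤-powersUpTo zero    = idn
    ≤-powersUpTo (suc n) = ≤-powersUpTo n ⨾ ∨-introˡ

    power-≤-closure : ∀ N →
      T ⊩ compose {Γ} (powersUpTo {Γ} ρ N) (powersUpTo {Γ} ρ N) ⇒ powersUpTo {Γ} ρ N →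
      ∀ m → T ⊩ power {Γ} ρ m ⇒ powersUpTo {Γ} ρ N
    power-≤-closure N trans zero    = ≤-powersUpTo N
    power-≤-closure N trans (suc m) = compose-mono (power-≤-closure N trans m) (≤-powersUpTo N) ⨾ trans

    powersUpTo-elim : ∀ {K χ : Fm (Γ ⧺ Γ)} → (∀ k → T ⊩ K ∧' power {Γ} ρ k ⇒ χ) →
                      ∀ n → T ⊩ K ∧' powersUpTo {Γ} ρ n ⇒ χ
    powersUpTo-elim h zero    = h zero
    powersUpTo-elim h (suc n) = distrib ⨾ ∨-elim (powersUpTo-elim h n) (h (suc n))

-- Runs of a definable automaton and its one-step reachability relation

module Runs (Sg : Signature) (T : Logic.Theory Sg) (Aut : Logic.Automaton Sg T) where
  open Signature Sg
  open Logic Sg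
  open Syntax Sg
  open Derivations Sg T
  open Automaton Aut
  open Relations Sg T {SC}

  σ-at : ∀ {Θ} → Ren Θ ΣC → Ren Θ SC → Ren Θ SC → Fm Θ
  σ-at a p q = ren ⟨ a , p , q ⟩ σ

  σ-at-typed : ∀ {Θ} (a : Ren Θ ΣC) (p q : Ren Θ SC) →
               T ⊩ σ-at a p q ⇒ ren a α ∧' ren p β ∧' ren q β
  σ-at-typed a p q = rename ⟨ a , p , q ⟩ σ-typed
    ⨾ cast refl (cong₂ _∧'_ (ren-⟨⟩-π₁ a p q α)
                            (cong₂ _∧'_ (ren-⟨⟩-π₂ a p q β) (ren-⟨⟩-π₃ a p q β))) idn

  σ-at-source : ∀ {Θ} (a : Ren Θ ΣC) (p p' q : Ren Θ SC) → T ⊩ eqs SC p' p ∧' σ-at a p' q ⇒ σ-at a p q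
  σ-at-source {Θ} a p p' q = cast (cong (_ ∧'_) (instance-eq p')) (instance-eq p) (eqs-subst SC p' p χ)
    where
      a↑ q↑ : Ren (Θ ⧺ SC) _
      a↑ v = wkL SC (a v)
      q↑ v = wkL SC (q v)
      χ : Fm (Θ ⧺ SC)
      χ = ren ⟨ a↑ , wkR Θ , q↑ ⟩ σ
      instance-eq : (g : Ren Θ SC) → ren ([_,_] {Θ} {SC} (λ x → x) g) χ ≡ σ-at a g q
      instance-eq g = ren²-⟨⟩ ι⟨g⟩ ⟨ a↑ , wkR Θ , q↑ ⟩ a g q
          (λ v → cong ι⟨g⟩ (⟨⟩-π₁ a↑ (wkR Θ) q↑ v) ∙ [,]-wkL {Δ = SC} (λ x → x) g (a v))
          (λ v → cong ι⟨g⟩ (⟨⟩-π₂ a↑ (wkR Θ) q↑ v) ∙ [,]-wkR {Δ = SC} (λ x → x) g v)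
          (λ v → cong ι⟨g⟩ (⟨⟩-π₃ a↑ (wkR Θ) q↑ v) ∙ [,]-wkL {Δ = SC} (λ x → x) g (q v)) σ
        where
          ι⟨g⟩ : Ren Θ (Θ ⧺ SC)
          ι⟨g⟩ = [_,_] {Θ} {SC} (λ x → x) g

  -- the one-step reachability relation R(s, s') = ∃ a. σ(a, s, s'); its body lives in
  -- the context (s , s' , a)
  s₀ s₀' : Ren ((SC ⧺ SC) ⧺ ΣC) SC
  s₀  = π₁ {SC} {SC} {ΣC}
  s₀' = π₂ {SC} {SC} {ΣC}
  a₀ : Ren ((SC ⧺ SC) ⧺ ΣC) ΣC
  a₀ = π₃ {SC} {SC} {ΣC}

  R : Fm (SC ⧺ SC)
  R = ∃* ΣC (σ-at a₀ s₀ s₀')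

  R-at : ∀ {Θ} (p q : Ren Θ SC) →
         ren ⟦ p , q ⟧ R ≡ ∃* ΣC (σ-at (wkR Θ) (λ v → wkL ΣC (p v)) (λ v → wkL ΣC (q v)))
  R-at {Θ} p q = ren-∃* ΣC ⟦ p , q ⟧ _ ∙ cong (∃* ΣC) (ren²-⟨⟩ ν ⟨ a₀ , s₀ , s₀' ⟩ _ _ _
      (λ v → cong ν (⟨⟩-π₁ a₀ s₀ s₀' v) ∙ [,]-wkR {Δ = ΣC} _ (wkR Θ) v)
      (λ v → cong ν (⟨⟩-π₂ a₀ s₀ s₀' v) ∙ [,]-wkL {Δ = ΣC} _ (wkR Θ) _
             ∙ cong (wkL ΣC) ([,]-wkL {Δ = SC} p q v))
      (λ v → cong ν (⟨⟩-π₃ a₀ s₀ s₀' v) ∙ [,]-wkL {Δ = ΣC} _ (wkR Θ) _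
             ∙ cong (wkL ΣC) ([,]-wkR {Δ = SC} p q v)) σ)
    where
      ν : Ren (Θ ⧺ ΣC) ((SC ⧺ SC) ⧺ ΣC)
      ν = [_,_] {SC ⧺ SC} {ΣC} (λ y → wkL ΣC (⟦ p , q ⟧ y)) (wkR Θ)

  R-intro : ∀ {Θ} (a : Ren Θ ΣC) (p q : Ren Θ SC) → T ⊩ σ-at a p q ⇒ ren ⟦ p , q ⟧ R
  R-intro a p q = ∃*-witness ΣC _ ⟦ p , q ⟧ a (cast refl (sym instance-eq) idn)
    where
      pqa = ⟨ p , q , a ⟩
      instance-eq : ren pqa (σ-at a₀ s₀ s₀') ≡ σ-at a p q
      instance-eq = ren²-⟨⟩ pqa _ a p q
        (λ v → cong pqa (⟨⟩-π₁ a₀ s₀ s₀' v) ∙ ⟨⟩-π₃ p q a v)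
        (λ v → cong pqa (⟨⟩-π₂ a₀ s₀ s₀' v) ∙ ⟨⟩-π₁ p q a v)
        (λ v → cong pqa (⟨⟩-π₃ a₀ s₀ s₀' v) ∙ ⟨⟩-π₂ p q a v) σ

  R-elim : ∀ {Θ} (p q : Ren Θ SC) (K χ : Fm Θ) →
           T ⊩ ren (wkL ΣC) K ∧' σ-at (wkR Θ) (λ v → wkL ΣC (p v)) (λ v → wkL ΣC (q v)) ⇒ ren (wkL ΣC) χ →
           T ⊩ K ∧' ren ⟦ p , q ⟧ R ⇒ χ
  R-elim p q K χ h = cast (cong (K ∧'_) (sym (R-at p q))) refl (∃*-frobenius ΣC K _ ⨾ ∃*-elim ΣC h)

  -- the variables of the defining clause  σ̄ (suc n) (w a, s, s'') = ∃ s'. σ̄ n (w, s, s') ∧ σ(a, s', s'')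
  module σ̄-clause (n : ℕ) where
    C : Ctx
    C = (((Words n ⧺ ΣC) ⧺ SC) ⧺ SC) ⧺ SC
    w : Ren C (Words n)
    w v = wkL SC (wkL SC (wkL SC (wkL ΣC v)))
    a : Ren C ΣC
    a v = wkL SC (wkL SC (wkL SC (wkR (Words n) v)))
    s s'' s' : Ren C SC
    s v   = wkL SC (wkL SC (wkR (Words n ⧺ ΣC) v))
    s'' v = wkL SC (wkR ((Words n ⧺ ΣC) ⧺ SC) v)
    s'    = wkR (((Words n ⧺ ΣC) ⧺ SC) ⧺ SC)
    body : Fm C
    body = ren ⟨ w , s , s' ⟩ (σ̄ n) ∧' σ-at a s' s''

  Run : ∀ n → Fm ((Words n ⧺ SC) ⧺ SC)
  Run n = ren (λ v → wkL SC (wkL SC v)) (letters n) ∧' σ̄ n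

  run-at : ∀ n {Θ} → Ren Θ (Words n) → Ren Θ SC → Ren Θ SC → Fm Θ
  run-at n w p q = ren ⟨ w , p , q ⟩ (Run n)

  snoc : ∀ n {Θ} → Ren Θ (Words n) → Ren Θ ΣC → Ren Θ (Words (suc n))
  snoc n w a = [_,_] {Words n} {ΣC} w a

  run-start : ∀ {Θ} (w : Ren Θ (Words 0)) (p : Ren Θ SC) → T ⊩ ren p β ⇒ run-at 0 w p p
  run-start w p =
    ∧-intro top (∧-intro (eqs-refl SC p ⨾ cast refl (sym equations) idn)
                         (cast refl (sym (ren-⟨⟩-π₂ w p p β)) idn))
    where
      equations : ren ⟨ w , p , p ⟩ (eqs SC (λ s → wkL SC (wkR (Words 0) s)) (wkR (Words 0 ⧺ SC))) ≡ eqs SC p p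
      equations = eqs-ren SC _ _ _ ∙ eqs-ext SC (⟨⟩-π₂ w p p) (⟨⟩-π₃ w p p)

  run-step : ∀ n {Θ} (w : Ren Θ (Words n)) (a : Ren Θ ΣC) (p z q : Ren Θ SC) →
             T ⊩ run-at n w p z ∧' σ-at a z q ⇒ run-at (suc n) (snoc n w a) p q
  run-step n w a p z q =
    ∧-intro (∧-intro (∧-elimˡ ⨾ ∧-elimˡ ⨾ cast refl (ren-⟨⟩-π₁ w p z (letters n)) idn)
                     (∧-elimʳ ⨾ σ-at-typed a z q ⨾ ∧-elimˡ)
             ⨾ cast refl (sym word-eq) idn)
            (∃*-witness SC V.body ρ z (∧-map ∧-elimʳ idn ⨾ cast refl (sym body-eq) idn))
    where
      module V = σ̄-clause n
      ρ = ⟨ snoc n w a , p , q ⟩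
      κ = [_,_] {(Words (suc n) ⧺ SC) ⧺ SC} {SC} ρ z
      word-eq : ren ρ (ren (λ v → wkL SC (wkL SC v)) (letters (suc n))) ≡ ren w (letters n) ∧' ren a α
      word-eq = ren-⟨⟩-π₁ (snoc n w a) p q (letters (suc n))
                ∙ cong₂ _∧'_ (ren-[,]-wkL w a (letters n)) (ren-[,]-wkR w a α)
      κ-w : ∀ {A} (v : Var (Words n) A) → κ (V.w v) ≡ w v
      κ-w v = [,]-wkL {Δ = SC} ρ z _ ∙ ⟨⟩-π₁ (snoc n w a) p q _ ∙ [,]-wkL {Δ = ΣC} w a v
      κ-a : ∀ {A} (v : Var ΣC A) → κ (V.a v) ≡ a v
      κ-a v = [,]-wkL {Δ = SC} ρ z _ ∙ ⟨⟩-π₁ (snoc n w a) p q _ ∙ [,]-wkR {Δ = ΣC} w a v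
      κ-s : ∀ {A} (v : Var SC A) → κ (V.s v) ≡ p v
      κ-s v = [,]-wkL {Δ = SC} ρ z _ ∙ ⟨⟩-π₂ (snoc n w a) p q v
      κ-s'' : ∀ {A} (v : Var SC A) → κ (V.s'' v) ≡ q v
      κ-s'' v = [,]-wkL {Δ = SC} ρ z _ ∙ ⟨⟩-π₃ (snoc n w a) p q v
      κ-s' : ∀ {A} (v : Var SC A) → κ (V.s' v) ≡ z v
      κ-s' v = [,]-wkR {Δ = SC} ρ z v
      body-eq : ren κ V.body ≡ ren ⟨ w , p , z ⟩ (σ̄ n) ∧' σ-at a z q
      body-eq = cong₂ _∧'_
        (ren²-⟨⟩ κ ⟨ V.w , V.s , V.s' ⟩ w p z
          (λ v → cong κ (⟨⟩-π₁ V.w V.s V.s' v) ∙ κ-w v)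
          (λ v → cong κ (⟨⟩-π₂ V.w V.s V.s' v) ∙ κ-s v)
          (λ v → cong κ (⟨⟩-π₃ V.w V.s V.s' v) ∙ κ-s' v) (σ̄ n))
        (ren²-⟨⟩ κ ⟨ V.a , V.s' , V.s'' ⟩ a z q
          (λ v → cong κ (⟨⟩-π₁ V.a V.s' V.s'' v) ∙ κ-a v)
          (λ v → cong κ (⟨⟩-π₂ V.a V.s' V.s'' v) ∙ κ-s' v)
          (λ v → cong κ (⟨⟩-π₃ V.a V.s' V.s'' v) ∙ κ-s'' v) σ)

  run-single : ∀ {Θ} (a : Ren Θ ΣC) (p q : Ren Θ SC) → T ⊩ σ-at a p q ⇒ run-at 1 (snoc 0 (λ ()) a) p q
  run-single a p q =
    ∧-intro (σ-at-typed a p q ⨾ ∧-elimʳ ⨾ ∧-elimˡ ⨾ run-start (λ ()) p) idn ⨾ run-step 0 (λ ()) a p p q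

  lang-intro : ∀ n {Θ} (w : Ren Θ (Words n)) (p q : Ren Θ SC) →
               T ⊩ run-at n w p q ∧' ren p ι ∧' ren q fin ⇒ ren w (lang n)
  lang-intro n w p q =
    ∧-intro (∧-elimˡ ⨾ ∧-elimˡ ⨾ cast refl (ren-⟨⟩-π₁ w p q (letters n)) idn)
            (∃*-witness SC _ w p (∃*-witness SC _ ([_,_] {Words n} {SC} w p) q
               (∧-intro (∧-elimʳ ⨾ ∧-elimˡ ⨾ cast refl (sym (ren-⟨⟩-π₂ w p q ι)) idn)
                        (∧-intro (∧-elimˡ ⨾ ∧-elimʳ)
                                 (∧-elimʳ ⨾ ∧-elimʳ ⨾ cast refl (sym (ren-⟨⟩-π₃ w p q fin)) idn)))))

  ends : ∀ W → Ren ((W ⧺ SC) ⧺ SC) (SC ⧺ SC)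
  ends W = ⟦ (λ v → wkL SC (wkR W v)) , wkR (W ⧺ SC) ⟧

  -- P k = R^(k+1)
  P : ℕ → Fm (SC ⧺ SC)
  P = power {SC} R

  ends-clause : ∀ n (φ : Fm (SC ⧺ SC)) →
                ren (wkL SC) (ren (ends (Words (suc n))) φ) ≡ ren ⟦ σ̄-clause.s n , σ̄-clause.s'' n ⟧ φ
  ends-clause n =
    ren-[,]-comp {Γ = SC} {SC} (wkL SC) (λ v → wkL SC (wkR (Words (suc n)) v)) (wkR (Words (suc n) ⧺ SC))

  run-power : ∀ m → T ⊩ σ̄ (suc m) ⇒ ren (ends (Words (suc m))) (P m)
  run-power zero = ∃*-elim SC
      (∧-intro (∧-elimˡ ⨾ ∧-elimˡ ⨾ cast equations refl (eqs-sym SC s s')) ∧-elimʳ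
       ⨾ σ-at-source a s s' s'' ⨾ R-intro a s s''
       ⨾ cast refl (sym (ends-clause 0 R)) idn)
    where
      open σ̄-clause 0
      equations : eqs SC s s' ≡ ren ⟨ w , s , s' ⟩ (eqs SC (λ v → wkL SC (wkR (Words 0) v)) (wkR (Words 0 ⧺ SC)))
      equations = sym (eqs-ren SC _ _ _ ∙ eqs-ext SC (⟨⟩-π₂ w s s') (⟨⟩-π₃ w s s'))
  run-power (suc m) = ∃*-elim SC
      (∧-map (rename ⟨ w , s , s' ⟩ (run-power m) ⨾ cast refl first-part idn) (R-intro a s' s'')
       ⨾ compose-intro s s' s'' (P m) R
       ⨾ cast refl (sym (ends-clause (suc m) (P (suc m)))) idn)
    where
      open σ̄-clause (suc m)
      first-part : ren ⟨ w , s , s' ⟩ (ren (ends (Words (suc m))) (P m)) ≡ ren ⟦ s , s' ⟧ (P m)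
      first-part = ren²-[,] ⟨ w , s , s' ⟩ (ends (Words (suc m))) s s'
        (λ v → cong ⟨ w , s , s' ⟩ ([,]-wkL {Δ = SC} (λ v → wkL SC (wkR (Words (suc m)) v)) _ v)
               ∙ ⟨⟩-π₂ w s s' v)
        (λ v → cong ⟨ w , s , s' ⟩ ([,]-wkR {Δ = SC} (λ v → wkL SC (wkR (Words (suc m)) v)) _ v)
               ∙ ⟨⟩-π₃ w s s' v) (P m)

  RunsEntail : ℕ → ∀ {Θ} → Ren Θ SC → Ren Θ SC → Fm Θ → Fm Θ → Set
  RunsEntail n {Θ} p q K χ = ∀ {Δ} (ρ : Ren Δ Θ) (w : Ren Δ (Words n)) →
    T ⊩ run-at n w (λ v → ρ (p v)) (λ v → ρ (q v)) ∧' ren ρ K ⇒ ren ρ χ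

  power-elim : ∀ k {Θ} (p q : Ren Θ SC) (K χ : Fm Θ) → RunsEntail (suc k) p q K χ →
               T ⊩ K ∧' ren ⟦ p , q ⟧ (P k) ⇒ χ
  power-elim zero {Θ} p q K χ h =
    R-elim p q K χ (∧-intro (∧-elimʳ ⨾ run-single (wkR Θ) _ _) ∧-elimˡ
                    ⨾ h (wkL ΣC) (snoc 0 (λ ()) (wkR Θ)))
  power-elim (suc k) {Θ} p q K χ h =
    compose-elim p q (P k) R K χ
      (∧-intro (∧-intro (∧-elimʳ ⨾ ∧-elimʳ) ∧-elimˡ) (∧-elimʳ ⨾ ∧-elimˡ)
       ⨾ power-elim k p↑ z (ren ⟦ z , q↑ ⟧ R ∧' ren (wkL SC) K) (ren (wkL SC) χ) last-step)
    where
      p↑ q↑ z : Ren (Θ ⧺ SC) SC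
      p↑ v = wkL SC (p v)
      q↑ v = wkL SC (q v)
      z    = wkR Θ
      last-step : RunsEntail (suc k) p↑ z (ren ⟦ z , q↑ ⟧ R ∧' ren (wkL SC) K) (ren (wkL SC) χ)
      last-step {Δ} ρ w =
        ∧-intro (∧-intro ∧-elimˡ (∧-elimʳ ⨾ ∧-elimʳ))
                (∧-elimʳ ⨾ ∧-elimˡ ⨾ cast refl (ren-[,]-comp {Γ = SC} {SC} ρ z q↑ R) idn)
        ⨾ R-elim (λ v → ρ (z v)) (λ v → ρ (q↑ v)) _ _
            (∧-intro (∧-map (∧-elimˡ ⨾ cast refl (ren-⟨⟩-comp w (λ v → ρ (p↑ v)) (λ v → ρ (z v))
                                                           (wkL ΣC) (Run (suc k))) idn) idn
                      ⨾ run-step (suc k) (λ v → wkL ΣC (w v)) (wkR Δ) _ _ _)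
                     (∧-elimˡ ⨾ ∧-elimʳ ⨾ cast refl (shift K) idn)
             ⨾ h (λ x → wkL ΣC (ρ (wkL SC x))) _
             ⨾ cast refl (sym (shift χ)) idn)
        where
          shift : (φ : Fm Θ) → ren (wkL ΣC) (ren ρ (ren (wkL SC) φ)) ≡ ren (λ x → wkL ΣC (ρ (wkL SC x))) φ
          shift φ = ren-ren (wkL ΣC) ρ _ ∙ ren-ren _ (wkL SC) φ

  Accepts : Fm (SC ⧺ SC) → Fm (SC ⧺ SC)
  Accepts ρ = (ren (wkL SC) ι ∧' ren (wkR SC) fin) ∧' ρ

  no-accepting-power : LanguageEmpty → ∀ k → T ⊩ Accepts (P k) ⇒ ⊥'
  no-accepting-power empty k =
    cast (cong (_ ∧'_) (ren-[,]-η {SC} {SC} (P k))) refl (power-elim k (wkL SC) (wkR SC) _ ⊥' refute)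
    where
      refute : RunsEntail (suc k) (wkL SC) (wkR SC) (ren (wkL SC) ι ∧' ren (wkR SC) fin) ⊥'
      refute ρ w =
        ∧-intro ∧-elimˡ (∧-intro (∧-elimʳ ⨾ ∧-elimˡ ⨾ cast refl (ren-ren ρ (wkL SC) ι) idn)
                                 (∧-elimʳ ⨾ ∧-elimʳ ⨾ cast refl (ren-ren ρ (wkR SC) fin) idn))
        ⨾ lang-intro (suc k) w _ _ ⨾ rename w (empty (suc k))

  nonempty-words-rejected : ∀ m {ρ : Fm (SC ⧺ SC)} → (∀ k → T ⊩ P k ⇒ ρ) →
                          T ⊩ Accepts ρ ⇒ ⊥' → T ⊩ lang (suc m) ⇒ ⊥'
  nonempty-words-rejected m powers≤ρ refuted = ∧-elimʳ ⨾ ∃*-elim SC (∃*-elim SC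
      (∧-intro (∧-intro (∧-elimˡ ⨾ cast refl (sym (ren-[,]-wkL {Δ = SC} _ _ ι)) idn)
                        (∧-elimʳ ⨾ ∧-elimʳ ⨾ cast refl (sym (ren-[,]-wkR {Γ = SC} _ _ fin)) idn))
               (∧-elimʳ ⨾ ∧-elimˡ ⨾ run-power m ⨾ rename (ends (Words (suc m))) (powers≤ρ m))
       ⨾ rename (ends (Words (suc m))) refuted))

  emptiness-criterion : ∀ N →
    T ⊩ compose {SC} (powersUpTo {SC} R N) (powersUpTo {SC} R N) ⇒ powersUpTo {SC} R N →
    (T ⊩ lang 0 ⇒ ⊥' × T ⊩ Accepts (powersUpTo {SC} R N) ⇒ ⊥') ⇔ LanguageEmpty
  emptiness-criterion N transitive = mk⇔
    (λ { (rejects-ε , no-accepting) → λ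
      { zero    → rejects-ε
      ; (suc m) → nonempty-words-rejected m (power-≤-closure R N transitive) no-accepting } })
    (λ empty → empty 0 , powersUpTo-elim R (no-accepting-power empty) N)

mainTheorem6 : (Sg : Signature) → let open Logic Sg in
    (T : Theory) →
    HasDisjointCoproducts T →
    EliminatesImaginaries T →
    Decidable T →
    EliminatesTransitiveClosures T →
    (A : Automaton T) → Dec (Automaton.LanguageEmpty A)
mainTheorem6 Sg T _ _ decidable eliminates A with eliminates (Runs.R Sg T A)
... | N , transitive =
  map-dec (emptiness-criterion N transitive)
          (decidable (lang 0) ⊥' ×-dec decidable (Accepts (powersUpTo {SC} R N)) ⊥')
  where
    open Logic Sg
    open Automaton A
    open Runs Sg T A
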